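{- The subgroup $\mathcal N$ of $a\mathcal R$ consisting of the almost-Riordan arrays of the form $(a,1,x)$ is a normal subgroup of $a\mathcal R$.
   Context: All power series have integer coefficients. An almost-Riordan array is an ordered triple $(a,g,f)$ of power series with $a_0=1$, $g_0=1$, $f_0=0$, $f_1=1$, identified with the infinite lower-triangular matrix $M$ given by $M_{n,0}=a_n$, $M_{0,k}=0$ for $k\ge1$, $M_{n,k}=[x^{n-1}]g(x)f(x)^{k-1}$ for $n,k\ge1$. For a power series $h$, $(a,g,f)\cdot h$ is the power series whose coefficient sequence is $M(h_0,h_1,\dots)^T$. The group $a\mathcal R$ is the set of almost-Riordan arrays with product $(a,g,f)\cdot(b,u,v)=\big((a,g,f)\cdot b,\ g\,u(f),\ v(f)\big)$ and identity $(1,1,x)$ (this product coincides with matrix multiplication of the associated matrices). -}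

module Defs where

open import Data.Nat using (ℕ; zero; suc; _∸_)
open import Data.Integer using (ℤ; _+_; _*_; 0ℤ; 1ℤ)
open import Data.Product using (_×_)
open import Relation.Binary.PropositionalEquality using (_≡_)

PS : Set
PS = ℕ → ℤ

_≈ₚ_ : PS → PS → Set
f ≈ₚ g = ∀ n → f n ≡ g n

sumTo : ℕ → (ℕ → ℤ) → ℤ
sumTo zero f = f 0
sumTo (suc n) f = sumTo n f + f (suc n)

one : PS
one zero = 1ℤ
one (suc _) = 0ℤ

X : PS
X 1 = 1ℤ
X _ = 0ℤ

_⋆_ : PS → PS → PS
(f ⋆ g) n = sumTo n (λ i → f i * g (n ∸ i))

pow : PS → ℕ → PS
pow f zero = one
pow f (suc k) = f ⋆ pow f k

-- composition u(f), for f with f 0 = 0 (then [x^n] f^k = 0 for k > n)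
comp : PS → PS → PS
comp u f n = sumTo n (λ k → u k * pow f k n)

record Triple : Set where
  constructor ⟨_,_,_⟩
  field
    a : PS
    g : PS
    f : PS
open Triple public

IsARA : Triple → Set
IsARA A = (a A 0 ≡ 1ℤ) × (g A 0 ≡ 1ℤ) × (f A 0 ≡ 0ℤ) × (f A 1 ≡ 1ℤ)

-- (a,g,f)·h : coefficient sequence of M (h₀,h₁,...)ᵀ where
-- M_{n,0} = a_n, M_{0,k} = 0 (k ≥ 1), M_{n,k} = [x^{n-1}] g f^{k-1} (n,k ≥ 1)
-- (entries with k > n vanish since f₀ = 0; index j = k - 1)
act : Triple → PS → PS
act A h zero = a A 0 * h 0
act A h (suc m) = a A (suc m) * h 0 + sumTo m (λ j → (g A ⋆ pow (f A) j) m * h (suc j))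

_∙_ : Triple → Triple → Triple
A ∙ B = ⟨ act A (a B) , g A ⋆ comp (g B) (f A) , comp (f B) (f A) ⟩

idA : Triple
idA = ⟨ one , one , X ⟩

_≈A_ : Triple → Triple → Set
A ≈A B = (a A ≈ₚ a B) × (g A ≈ₚ g B) × (f A ≈ₚ f B)

InN : Triple → Set
InN A = IsARA A × (g A ≈ₚ one) × (f A ≈ₚ X)

-- The map (a, g, f) ↦ (g, f) is compatible with the product: the last two
-- components of A ∙ B depend only on those of A and B.  So it behaves like a
-- homomorphism onto the Riordan group, and 𝒩 is exactly the set of arrays
-- that it sends to the image (1, x) of the identity, i.e. its kernel.  Closure,
-- inverses and normality then come from A ∙ idA ∼ A, which rests on the
-- series identities h · 1(f) = h and x(f) = f (the latter because f₀ = 0).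
module Submission where

open import Defs
open import Data.Product using (_×_; _,_; proj₁)
open import Data.Nat using (ℕ; zero; suc; _∸_; _≤_; _<_; z≤n; s≤s; _≟_)
open import Data.Nat.Properties using (≤-refl; m≤n⇒m≤1+n; n∸n≡0; ≤∧≢⇒<; <⇒≢)
open import Data.Integer using (ℤ; 0ℤ; 1ℤ; _+_; _*_)
open import Data.Integer.Properties using (+-identityʳ; +-identityˡ; *-identityˡ; *-identityʳ; *-zeroˡ; *-zeroʳ)
open import Relation.Binary using (Setoid)
import Relation.Binary.Reasoning.Setoid as SetoidReasoning
open import Relation.Binary.PropositionalEquality
open import Relation.Nullary using (yes; no; contradiction)

sumTo-cong : ∀ n {F G : ℕ → ℤ} → (∀ i → F i ≡ G i) → sumTo n F ≡ sumTo n G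
sumTo-cong zero    e = e 0
sumTo-cong (suc n) e = cong₂ _+_ (sumTo-cong n e) (e (suc n))

sumTo-zero : ∀ n {F : ℕ → ℤ} → (∀ i → i ≤ n → F i ≡ 0ℤ) → sumTo n F ≡ 0ℤ
sumTo-zero zero    z = z 0 z≤n
sumTo-zero (suc n) z =
  cong₂ _+_ (sumTo-zero n (λ i i≤n → z i (m≤n⇒m≤1+n i≤n))) (z (suc n) ≤-refl)

sumTo-single : ∀ {n k} {F : ℕ → ℤ} → k ≤ n →
               (∀ i → i ≤ n → i ≢ k → F i ≡ 0ℤ) → sumTo n F ≡ F k
sumTo-single {zero} z≤n _ = refl
sumTo-single {suc n} {k} {F} k≤1+n z with k ≟ suc n
... | yes refl = begin
  sumTo n F + F (suc n) ≡⟨ cong (_+ F (suc n)) (sumTo-zero n below) ⟩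
  0ℤ + F (suc n)        ≡⟨ +-identityˡ (F (suc n)) ⟩
  F (suc n)             ∎
  where
  open ≡-Reasoning
  below : ∀ i → i ≤ n → F i ≡ 0ℤ
  below i i≤n = z i (m≤n⇒m≤1+n i≤n) (<⇒≢ (s≤s i≤n))
... | no k≢1+n with ≤∧≢⇒< k≤1+n k≢1+n
...   | s≤s k≤n = begin
  sumTo n F + F (suc n) ≡⟨ cong₂ _+_ (sumTo-single k≤n below) (z (suc n) ≤-refl (≢-sym k≢1+n)) ⟩
  F k + 0ℤ              ≡⟨ +-identityʳ (F k) ⟩
  F k                   ∎
  where
  open ≡-Reasoning
  below : ∀ i → i ≤ n → i ≢ k → F i ≡ 0ℤ
  below i i≤n = z i (m≤n⇒m≤1+n i≤n)

PS-setoid : Setoid _ _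
PS-setoid = ℕ →-setoid ℤ

module ≈ₚ = Setoid PS-setoid

⋆-cong : ∀ {f f′ g g′} → f ≈ₚ f′ → g ≈ₚ g′ → (f ⋆ g) ≈ₚ (f′ ⋆ g′)
⋆-cong ef eg n = sumTo-cong n (λ i → cong₂ _*_ (ef i) (eg (n ∸ i)))

pow-cong : ∀ {f g} → f ≈ₚ g → ∀ k → pow f k ≈ₚ pow g k
pow-cong e zero    = ≈ₚ.refl
pow-cong e (suc k) = ⋆-cong e (pow-cong e k)

comp-cong : ∀ {u u′ f f′} → u ≈ₚ u′ → f ≈ₚ f′ → comp u f ≈ₚ comp u′ f′
comp-cong eu ef n = sumTo-cong n (λ k → cong₂ _*_ (eu k) (pow-cong ef k n))

i<n⇒one[n∸i]≡0 : ∀ {i n} → i < n → one (n ∸ i) ≡ 0ℤ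
i<n⇒one[n∸i]≡0 {zero}  (s≤s _) = refl
i<n⇒one[n∸i]≡0 {suc i} (s≤s i<n) = i<n⇒one[n∸i]≡0 i<n

⋆-identityʳ : ∀ h → (h ⋆ one) ≈ₚ h
⋆-identityʳ h n = begin
  sumTo n (λ i → h i * one (n ∸ i)) ≡⟨ sumTo-single ≤-refl off-diagonal ⟩
  h n * one (n ∸ n)                 ≡⟨ cong (λ m → h n * one m) (n∸n≡0 n) ⟩
  h n * 1ℤ                          ≡⟨ *-identityʳ (h n) ⟩
  h n                               ∎
  where
  open ≡-Reasoning
  off-diagonal : ∀ i → i ≤ n → i ≢ n → h i * one (n ∸ i) ≡ 0ℤ
  off-diagonal i i≤n i≢n = trans (cong (h i *_) (i<n⇒one[n∸i]≡0 (≤∧≢⇒< i≤n i≢n))) (*-zeroʳ (h i))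

comp-one : ∀ h → comp one h ≈ₚ one
comp-one h n = begin
  sumTo n (λ k → one k * pow h k n) ≡⟨ sumTo-single z≤n higher ⟩
  1ℤ * one n                        ≡⟨ *-identityˡ (one n) ⟩
  one n                             ∎
  where
  open ≡-Reasoning
  higher : ∀ k → k ≤ n → k ≢ 0 → one k * pow h k n ≡ 0ℤ
  higher zero    _ 0≢0 = contradiction refl 0≢0
  higher (suc k) _ _   = *-zeroˡ (pow h (suc k) n)

k≢1⇒X[k]≡0 : ∀ {k} → k ≢ 1 → X k ≡ 0ℤ
k≢1⇒X[k]≡0 {zero}        _   = refl
k≢1⇒X[k]≡0 {suc zero}    1≢1 = contradiction refl 1≢1
k≢1⇒X[k]≡0 {suc (suc k)} _   = refl

comp-X : ∀ h → h 0 ≡ 0ℤ → comp X h ≈ₚ h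
comp-X h h₀ zero = trans (*-zeroˡ (pow h 0 0)) (sym h₀)
comp-X h h₀ n@(suc _) = begin
  sumTo n (λ k → X k * pow h k n) ≡⟨ sumTo-single (s≤s z≤n) off ⟩
  1ℤ * (h ⋆ one) n                ≡⟨ *-identityˡ ((h ⋆ one) n) ⟩
  (h ⋆ one) n                     ≡⟨ ⋆-identityʳ h n ⟩
  h n                             ∎
  where
  open ≡-Reasoning
  off : ∀ k → k ≤ n → k ≢ 1 → X k * pow h k n ≡ 0ℤ
  off k _ k≢1 = trans (cong (_* pow h k n) (k≢1⇒X[k]≡0 k≢1)) (*-zeroˡ (pow h k n))

-- A record rather than a product, so that A and B can be inferred from a proof of A ∼ B.
record _∼_ (A B : Triple) : Set where
  constructor _,_
  field
    g-≈ : g A ≈ₚ g B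
    f-≈ : f A ≈ₚ f B

∼-setoid : Setoid _ _
∼-setoid = record
  { Carrier       = Triple
  ; _≈_           = _∼_
  ; isEquivalence = record
    { refl  = ≈ₚ.refl , ≈ₚ.refl
    ; sym   = λ (eg , ef) → ≈ₚ.sym eg , ≈ₚ.sym ef
    ; trans = λ (eg , ef) (eg′ , ef′) → ≈ₚ.trans eg eg′ , ≈ₚ.trans ef ef′
    }
  }

module ∼ = Setoid ∼-setoid

∙-cong-∼ : ∀ {A A′ B B′} → A ∼ A′ → B ∼ B′ → (A ∙ B) ∼ (A′ ∙ B′)
∙-cong-∼ (gA , fA) (gB , fB) = ⋆-cong gA (comp-cong gB fA) , comp-cong fB fA

∙-identityʳ-∼ : ∀ A → f A 0 ≡ 0ℤ → (A ∙ idA) ∼ A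
∙-identityʳ-∼ A f₀ =
  ≈ₚ.trans (⋆-cong (≈ₚ.refl {g A}) (comp-one (f A))) (⋆-identityʳ (g A)) , comp-X (f A) f₀

≈A⇒∼ : ∀ {A B} → A ≈A B → A ∼ B
≈A⇒∼ (_ , eg , ef) = eg , ef

InN⇒∼idA : ∀ {N} → InN N → N ∼ idA
InN⇒∼idA (_ , eg , ef) = eg , ef

∼idA⇒InN : ∀ {N} → a N 0 ≡ 1ℤ → N ∼ idA → InN N
∼idA⇒InN a₀ (eg , ef) = (a₀ , eg 0 , ef 0 , ef 1) , eg , ef

∙-a₀ : ∀ A B → a A 0 ≡ 1ℤ → a B 0 ≡ 1ℤ → a (A ∙ B) 0 ≡ 1ℤ
∙-a₀ _ _ a₀ b₀ = cong₂ _*_ a₀ b₀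

mainTheorem7 : InN idA
    × (∀ N M → InN N → InN M → InN (N ∙ M))
    × (∀ N M → InN N → IsARA M → (N ∙ M) ≈A idA → (M ∙ N) ≈A idA → InN M)
    × (∀ A B N → IsARA A → IsARA B → (A ∙ B) ≈A idA → (B ∙ A) ≈A idA
         → InN N → InN ((A ∙ N) ∙ B))
mainTheorem7 = ∼idA⇒InN refl ∼.refl , closed , inverse , normal
  where
  open SetoidReasoning ∼-setoid

  closed : ∀ N M → InN N → InN M → InN (N ∙ M)
  closed N M N∈ M∈ = ∼idA⇒InN (∙-a₀ N M (proj₁ (proj₁ N∈)) (proj₁ (proj₁ M∈))) (begin
    N ∙ M     ≈⟨ ∙-cong-∼ (InN⇒∼idA N∈) (InN⇒∼idA M∈) ⟩
    idA ∙ idA ≈⟨ ∙-identityʳ-∼ idA refl ⟩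
    idA       ∎)

  inverse : ∀ N M → InN N → IsARA M → (N ∙ M) ≈A idA → (M ∙ N) ≈A idA → InN M
  inverse N M N∈ (a₀ , _ , f₀ , _) _ MN≈id = ∼idA⇒InN a₀ (begin
    M       ≈⟨ ∙-identityʳ-∼ M f₀ ⟨
    M ∙ idA ≈⟨ ∙-cong-∼ (∼.refl {M}) (InN⇒∼idA N∈) ⟨
    M ∙ N   ≈⟨ ≈A⇒∼ MN≈id ⟩
    idA     ∎)

  normal : ∀ A B N → IsARA A → IsARA B → (A ∙ B) ≈A idA → (B ∙ A) ≈A idA
           → InN N → InN ((A ∙ N) ∙ B)
  normal A B N (a₀ , _ , f₀ , _) (b₀ , _) AB≈id _ N∈ =
    ∼idA⇒InN (∙-a₀ (A ∙ N) B (∙-a₀ A N a₀ (proj₁ (proj₁ N∈))) b₀) (begin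
      (A ∙ N) ∙ B   ≈⟨ ∙-cong-∼ (∙-cong-∼ (∼.refl {A}) (InN⇒∼idA N∈)) (∼.refl {B}) ⟩
      (A ∙ idA) ∙ B ≈⟨ ∙-cong-∼ (∙-identityʳ-∼ A f₀) (∼.refl {B}) ⟩
      A ∙ B         ≈⟨ ≈A⇒∼ AB≈id ⟩
      idA           ∎)
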